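{- Let $m = p_1^{e_1}\cdots p_r^{e_r}$, $R=\{1,\dots,r\}$, $\emptyset \neq I \subsetneq R$, and let $C_I$ be the connected component of the sequential power graph of $\mathbb{Z}/m\mathbb{Z}$ containing $d_I$. Then the number of tails in $C_I$ is $$\sum_{\substack{y \mid \frac{g_I}{\pi_I}\\ y \neq \frac{g_I}{\pi_I}}} \phi\!\left(\frac{m}{y\pi_I}\right),$$ where $y$ ranges over positive divisors and $\phi$ is Euler's totient function.
   Context: $m = p_1^{e_1}\cdots p_r^{e_r}$ with distinct primes, $e_i\ge1$. For $I\subseteq R$: $\pi_I=\prod_{i\in I}p_i$, $g_I = \prod_{i\in I} p_i^{e_i}$, and $d_I$ is the idempotent with $d_I\equiv 0\pmod{p_i^{e_i}}$ for $i\in I$, $d_I\equiv1\pmod{p_j^{e_j}}$ for $j\notin I$. The sequential power graph of $\mathbb{Z}/m\mathbb{Z}$ is the directed graph on $\mathbb{Z}/m\mathbb{Z}$ with an edge $(b,c)$ iff $b\equiv a^i$, $c\equiv a^{i+1}\pmod m$ for some $a$ and $i\in\mathbb{N}$; connected components are with respect to undirected paths. An element $v$ is a tail if $v^{k+1}\not\equiv v\pmod m$ for all $k\ge1$. -}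

module Defs where

open import Data.Nat using (ℕ; zero; suc; _+_; _*_; _^_; _≤_; _<_; _%_; _/_)
open import Data.Nat.GCD using (gcd)
open import Data.Nat.Divisibility using (_∣_)
open import Data.Fin using (Fin)
open import Data.Bool using (Bool; true; false; if_then_else_)
open import Data.List using (List; []; _∷_; length; filter; upTo; map)
open import Data.Nat.ListAction using (sum)
open import Data.Product using (Σ; ∃; _×_; _,_)
open import Relation.Binary.PropositionalEquality using (_≡_)
open import Relation.Nullary using (¬_)
open import Data.Nat using (_≟_)
open import Relation.Nullary.Decidable using (¬?)
open import Data.Nat.Divisibility using (_∣?_)

prodFin : ∀ {r} → (Fin r → ℕ) → ℕ
prodFin {zero}  f = 1
prodFin {suc r} f = f Fin.zero * prodFin (λ i → f (Fin.suc i))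

-- residue of a modulo m (for m = 0 we leave a unchanged; never used with m = 0)
_modN_ : ℕ → ℕ → ℕ
a modN zero    = a
a modN (suc n) = a % suc n

-- exact quotient n / k (k = 0 gives 0; never used with k = 0)
_divN_ : ℕ → ℕ → ℕ
n divN zero    = 0
n divN (suc k) = n / suc k

_≡[mod_]_ : ℕ → ℕ → ℕ → Set
a ≡[mod m ] b = a modN m ≡ b modN m

φ : ℕ → ℕ
φ n = length (filter (λ k → gcd k n ≟ 1) (map suc (upTo n)))

modulus : ∀ {r} → (Fin r → ℕ) → (Fin r → ℕ) → ℕ
modulus p e = prodFin (λ i → p i ^ e i)

πI : ∀ {r} → (Fin r → ℕ) → (Fin r → Bool) → ℕ
πI p I = prodFin (λ i → if I i then p i else 1)

gI : ∀ {r} → (Fin r → ℕ) → (Fin r → ℕ) → (Fin r → Bool) → ℕ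
gI p e I = prodFin (λ i → if I i then p i ^ e i else 1)

-- d is the idempotent d_I (elements of ℤ/mℤ are represented by d < m)
IsDI : ∀ {r} → (Fin r → ℕ) → (Fin r → ℕ) → (Fin r → Bool) → ℕ → Set
IsDI p e I d = d < modulus p e
  × (∀ i → I i ≡ true  → d ≡[mod p i ^ e i ] 0)
  × (∀ i → I i ≡ false → d ≡[mod p i ^ e i ] 1)

-- Edge (b , c) of the sequential power graph of ℤ/mℤ:
-- b ≡ a^i, c ≡ a^(i+1) (mod m) for some a and some i ∈ ℕ = {1,2,…}
Edge : ℕ → ℕ → ℕ → Set
Edge m b c = b < m × c < m ×
  ∃ λ a → ∃ λ i → 1 ≤ i × b ≡[mod m ] (a ^ i) × c ≡[mod m ] (a ^ suc i)

data Connected (m : ℕ) : ℕ → ℕ → Set where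
  here : ∀ {b} → b < m → Connected m b b
  fwd  : ∀ {b c d} → Connected m b c → Edge m c d → Connected m b d
  bwd  : ∀ {b c d} → Connected m b c → Edge m d c → Connected m b d

IsTail : ℕ → ℕ → Set
IsTail m v = ∀ k → 1 ≤ k → ¬ ((v ^ suc k) ≡[mod m ] v)

sumProperDivisors : ℕ → (ℕ → ℕ) → ℕ
sumProperDivisors h f =
  sum (map f (filter (λ y → ¬? (y ≟ h)) (filter (λ y → y ∣? h) (map suc (upTo h)))))

module Submission where

-- Write q_k = p_k^e_k, so m = ∏ q_k, and say that v has support I when p_k ∣ v
-- exactly for k ∈ I.  The ends a^i, a^(i+1) of an edge have the same prime divisors,
--     so the vertices connected to d_I have support I.  Conversely some power v^N
--     is idempotent mod m; an idempotent of support I is ≡ 0 mod q_k for k ∈ I and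
--     ≡ 1 for k ∉ I, hence ≡ d_I by the Chinese remainder theorem, and the chain
--     v, v², …, v^N joins v to d_I.  So C_I = {v < m : v has support I}.
--  2. Tails.  If v has support I and v^(k+1) ≡ v (k ≥ 1) then q_k ∣ v for k ∈ I,
--     i.e. g_I ∣ v; conversely, if g_I ∣ v then v^(N+1) ≡ v·d_I ≡ v.
--  3. Counting.  With m = g_I·m′, support I means π_I ∣ v and gcd(v, m′) = 1; with
--     g_I ∤ v this says gcd(v, m) = y·π_I for a proper divisor y of g_I/π_I.  The
--     v < m with gcd(v, m) = D are the D·k for the totatives k of m/D.

open import Defs
open import Data.Nat
  using (ℕ; zero; suc; _+_; _*_; _∸_; _^_; _≤_; _<_; _%_; _/_; _≟_; NonZero; z≤n; s≤s;
         >-nonZero; >-nonZero⁻¹; ≢-nonZero; ≢-nonZero⁻¹; nonTrivial⇒≢1; nonTrivial⇒n>1)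
open import Data.Nat.Properties
open import Data.Nat.Divisibility
open import Data.Nat.DivMod
open import Data.Nat.GCD
open import Data.Nat.Coprimality as Coprimality using (Coprime; coprime-divisor)
open import Data.Nat.Primality
  using (Prime; euclidsLemma; prime⇒irreducible; prime⇒nonZero; prime⇒nonTrivial)
open import Data.Nat.Tactic.RingSolver using (solve-∀)
open import Data.Nat.ListAction using (sum)
open import Data.Fin as Fin using (Fin; toℕ; fromℕ<)
import Data.Fin.Properties as Finₚ
open import Data.Bool using (Bool; true; false; if_then_else_)
open import Data.List using (List; []; _∷_; length; filter; upTo; map; concat)
open import Data.List.Properties using (length-++; length-map; map-cong)
open import Data.List.Membership.Propositional using (_∈_)
open import Data.List.Membership.Propositional.Properties
  using (∈-map⁺; ∈-map⁻; ∈-filter⁺; ∈-filter⁻; ∈-upTo⁺; ∈-upTo⁻; ∈-concat⁺′; ∈-concat⁻′)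
open import Data.List.Relation.Unary.All as All using (All; []; _∷_)
open import Data.List.Relation.Unary.AllPairs using ([]; _∷_)
open import Data.List.Relation.Unary.Unique.Propositional using (Unique)
import Data.List.Relation.Unary.Unique.Propositional.Properties as Unique
open import Data.List.Relation.Binary.Disjoint.Propositional using (Disjoint)
open import Data.Sum using (inj₁; inj₂)
open import Data.Product using (∃; _×_; _,_; proj₁; proj₂)
open import Data.Empty using (⊥-elim)
open import Relation.Nullary using (¬_; contradiction)
open import Relation.Nullary.Decidable using (¬?)
open import Relation.Binary.PropositionalEquality
open import Function.Base using (_∘_)
open import Function.Bundles using (_⇔_; mk⇔)
open import Function.Definitions using (Injective)

modN≡% : ∀ a n .{{_ : NonZero n}} → a modN n ≡ a % n
modN≡% a (suc n) = refl

≡[mod]⇒%≡ : ∀ {a b} n .{{_ : NonZero n}} → a ≡[mod n ] b → a % n ≡ b % n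
≡[mod]⇒%≡ {a} {b} n eq = trans (sym (modN≡% a n)) (trans eq (modN≡% b n))

%≡⇒≡[mod] : ∀ {a b} n .{{_ : NonZero n}} → a % n ≡ b % n → a ≡[mod n ] b
%≡⇒≡[mod] {a} {b} n eq = trans (modN≡% a n) (trans eq (sym (modN≡% b n)))

module _ (n : ℕ) .{{_ : NonZero n}} where

  %-cong-*ˡ : ∀ c {a b} → a % n ≡ b % n → (c * a) % n ≡ (c * b) % n
  %-cong-*ˡ c {a} {b} eq = begin
    (c * a) % n             ≡⟨ %-distribˡ-* c a n ⟩
    ((c % n) * (a % n)) % n ≡⟨ cong (λ z → ((c % n) * z) % n) eq ⟩
    ((c % n) * (b % n)) % n ≡⟨ sym (%-distribˡ-* c b n) ⟩
    (c * b) % n             ∎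
    where open ≡-Reasoning

  %≡⇒∣∸ : ∀ {a b} → b ≤ a → a % n ≡ b % n → n ∣ a ∸ b
  %≡⇒∣∸ {a} {b} b≤a eq = divides (a / n ∸ b / n) (begin
    a ∸ b                                     ≡⟨ cong₂ _∸_ (m≡m%n+[m/n]*n a n) (m≡m%n+[m/n]*n b n) ⟩
    (a % n + a / n * n) ∸ (b % n + b / n * n) ≡⟨ cong (λ z → (z + a / n * n) ∸ (b % n + b / n * n)) eq ⟩
    (b % n + a / n * n) ∸ (b % n + b / n * n) ≡⟨ [m+n]∸[m+o]≡n∸o (b % n) _ _ ⟩
    a / n * n ∸ b / n * n                     ≡⟨ sym (*-distribʳ-∸ n (a / n) (b / n)) ⟩
    (a / n ∸ b / n) * n                       ∎)
    where open ≡-Reasoning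

  ∣∸⇒%≡ : ∀ {a b} → b ≤ a → n ∣ a ∸ b → a % n ≡ b % n
  ∣∸⇒%≡ {a} {b} b≤a (divides k eq) = begin
    a % n           ≡⟨ cong (_% n) (sym (m+[n∸m]≡n b≤a)) ⟩
    (b + (a ∸ b)) % n ≡⟨ cong (λ z → (b + z) % n) eq ⟩
    (b + k * n) % n ≡⟨ [m+kn]%n≡m%n b k n ⟩
    b % n           ∎
    where open ≡-Reasoning

  ∣∧∣⇒%≡ : ∀ {a b} → n ∣ a → n ∣ b → a % n ≡ b % n
  ∣∧∣⇒%≡ {a} {b} n∣a n∣b = trans (n∣m⇒m%n≡0 a n n∣a) (sym (n∣m⇒m%n≡0 b n n∣b))

  *suc%≡⇒∣ : ∀ x z → (x * suc z) % n ≡ x % n → n ∣ x * z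
  *suc%≡⇒∣ x z eq = subst (n ∣_) x*suc[z]∸x≡x*z (%≡⇒∣∸ (m≤m*n x (suc z)) eq)
    where
    x*suc[z]∸x≡x*z : x * suc z ∸ x ≡ x * z
    x*suc[z]∸x≡x*z = trans (cong (_∸ x) (*-suc x z)) (m+n∸m≡n x (x * z))

%≡-∣ : ∀ k n .{{_ : NonZero k}} .{{_ : NonZero n}} → k ∣ n → ∀ {a b} → a % n ≡ b % n → a % k ≡ b % k
%≡-∣ k n k∣n {a} {b} eq = begin
  a % k     ≡⟨ sym (m∣n⇒o%n%m≡o%m k n a k∣n) ⟩
  a % n % k ≡⟨ cong (_% k) eq ⟩
  b % n % k ≡⟨ m∣n⇒o%n%m≡o%m k n b k∣n ⟩
  b % k     ∎
  where open ≡-Reasoning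

∣-resp-%≡ : ∀ k n .{{_ : NonZero k}} .{{_ : NonZero n}} → k ∣ n → ∀ {a b} → a % n ≡ b % n → k ∣ a → k ∣ b
∣-resp-%≡ k n k∣n {a} {b} eq k∣a =
  m%n≡0⇒n∣m b k (trans (sym (%≡-∣ k n k∣n eq)) (n∣m⇒m%n≡0 a k k∣a))

coprime-1 : ∀ x → Coprime x 1
coprime-1 x (_ , d∣1) = ∣1⇒≡1 d∣1

coprime-∣ˡ : ∀ {x y d} → d ∣ x → Coprime x y → Coprime d y
coprime-∣ˡ d∣x c (a , b) = c (∣-trans a d∣x , b)

coprime-∣ʳ : ∀ {x y d} → d ∣ y → Coprime x y → Coprime x d
coprime-∣ʳ d∣y c (a , b) = c (a , ∣-trans b d∣y)

coprime-*ʳ : ∀ {x a b} → Coprime x a → Coprime x b → Coprime x (a * b)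
coprime-*ʳ ca cb (d∣x , d∣ab) = cb (d∣x , coprime-divisor (coprime-∣ˡ d∣x ca) d∣ab)

coprime-^ʳ : ∀ {x y} n → Coprime x y → Coprime x (y ^ n)
coprime-^ʳ zero    c = coprime-1 _
coprime-^ʳ (suc n) c = coprime-*ʳ c (coprime-^ʳ n c)

coprime-^ˡ : ∀ {x y} m → Coprime x y → Coprime (x ^ m) y
coprime-^ˡ m c = Coprimality.sym (coprime-^ʳ m (Coprimality.sym c))

coprime-^ : ∀ {x y} m n → Coprime x y → Coprime (x ^ m) (y ^ n)
coprime-^ m n c = coprime-^ʳ n (coprime-^ˡ m c)

coprime-∣-* : ∀ {a b x} → Coprime a b → a ∣ x → b ∣ x → a * b ∣ x
coprime-∣-* {a} {b} cab (divides k refl) b∣x = subst (a * b ∣_) (*-comm a k)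
  (*-monoʳ-∣ a (coprime-divisor (Coprimality.sym cab) (subst (b ∣_) (*-comm k a) b∣x)))

prime≢1 : ∀ {p} → Prime p → p ≢ 1
prime≢1 {p} pr = nonTrivial⇒≢1 {{prime⇒nonTrivial pr}}

prime∤1 : ∀ {p} → Prime p → ¬ p ∣ 1
prime∤1 pr p∣1 = prime≢1 pr (∣1⇒≡1 p∣1)

prime∤⇒coprime : ∀ {p x} → Prime p → ¬ p ∣ x → Coprime p x
prime∤⇒coprime pr p∤x (d∣p , d∣x) with prime⇒irreducible pr d∣p
... | inj₁ d≡1 = d≡1
... | inj₂ refl = ⊥-elim (p∤x d∣x)

primes-coprime : ∀ {p p′} → Prime p → Prime p′ → p ≢ p′ → Coprime p p′
primes-coprime {p} {p′} pr pr′ p≢p′ = prime∤⇒coprime pr p∤p′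
  where
  p∤p′ : ¬ p ∣ p′
  p∤p′ p∣p′ with prime⇒irreducible pr′ p∣p′
  ... | inj₁ p≡1 = prime≢1 pr p≡1
  ... | inj₂ p≡p′ = p≢p′ p≡p′

prime∣^⇒∣ : ∀ {p x} n → Prime p → p ∣ x ^ n → p ∣ x
prime∣^⇒∣ zero pr p∣1 = ⊥-elim (prime∤1 pr p∣1)
prime∣^⇒∣ {x = x} (suc n) pr p∣x^suc[n] with euclidsLemma x (x ^ n) pr p∣x^suc[n]
... | inj₁ p∣x = p∣x
... | inj₂ p∣x^n = prime∣^⇒∣ n pr p∣x^n

∣⇒∣^suc : ∀ {p x} n → p ∣ x → p ∣ x ^ suc n
∣⇒∣^suc {x = x} n p∣x = ∣m⇒∣m*n (x ^ n) p∣x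

-- Two facts about congruences modulo a prime power p^e, both resting on
-- the coprimality of p^e with every number not divisible by p.
module _ {p : ℕ} (prime : Prime p) (e : ℕ) where

  private instance
    p^e≢0 : NonZero (p ^ e)
    p^e≢0 = m^n≢0 p e {{prime⇒nonZero prime}}

  -- If x·z ≡ x (mod p^e) and p ∣ z, then p^e ∣ x (z − 1 is a unit mod p).
  fixed-by-multiple-of-p : ∀ x z → p ∣ z → (x * z) % (p ^ e) ≡ x % (p ^ e) → p ^ e ∣ x
  fixed-by-multiple-of-p x zero    _   eq =
    m%n≡0⇒n∣m x (p ^ e) (trans (sym eq) (trans (cong (_% (p ^ e)) (*-zeroʳ x)) (n∣m⇒m%n≡0 0 (p ^ e) ((p ^ e) ∣0))))
  fixed-by-multiple-of-p x (suc z) p∣1+z eq =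
    coprime-divisor (coprime-^ˡ e (prime∤⇒coprime prime p∤z))
      (subst (p ^ e ∣_) (*-comm x z) (*suc%≡⇒∣ (p ^ e) x z eq))
    where
    p∤z : ¬ p ∣ z
    p∤z p∣z = prime∤1 prime (∣m+n∣m⇒∣n (subst (p ∣_) (+-comm 1 z) p∣1+z) p∣z)

  idempotent-unit≡1 : ∀ w → ¬ p ∣ w → (w * w) % (p ^ e) ≡ w % (p ^ e) → w % (p ^ e) ≡ 1 % (p ^ e)
  idempotent-unit≡1 zero    p∤0 _  = ⊥-elim (p∤0 (p ∣0))
  idempotent-unit≡1 (suc w) p∤w eq = ∣∸⇒%≡ (p ^ e) (s≤s z≤n)
    (coprime-divisor (coprime-^ˡ e (prime∤⇒coprime prime p∤w)) (*suc%≡⇒∣ (p ^ e) (suc w) w eq))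

module _ (n : ℕ) .{{_ : NonZero n}} (v : ℕ) where

  pow-shift : ∀ s {a b} → v ^ a % n ≡ v ^ b % n → v ^ (s + a) % n ≡ v ^ (s + b) % n
  pow-shift s {a} {b} eq = begin
    v ^ (s + a) % n     ≡⟨ cong (_% n) (^-distribˡ-+-* v s a) ⟩
    (v ^ s * v ^ a) % n ≡⟨ %-cong-*ˡ n (v ^ s) eq ⟩
    (v ^ s * v ^ b) % n ≡⟨ cong (_% n) (sym (^-distribˡ-+-* v s b)) ⟩
    v ^ (s + b) % n     ∎
    where open ≡-Reasoning

  pow-periodic : ∀ {a t} → v ^ (a + t) % n ≡ v ^ a % n →
                 ∀ c s → v ^ (s + a + c * t) % n ≡ v ^ (s + a) % n
  pow-periodic {a} {t} period zero s = cong (λ k → v ^ k % n) (+-identityʳ (s + a))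
  pow-periodic {a} {t} period (suc c) s = begin
    v ^ (s + a + (t + c * t)) % n ≡⟨ cong (λ k → v ^ k % n) (regroup s a t c) ⟩
    v ^ (s + c * t + (a + t)) % n ≡⟨ pow-shift (s + c * t) period ⟩
    v ^ (s + c * t + a) % n       ≡⟨ cong (λ k → v ^ k % n) (swap s a (c * t)) ⟩
    v ^ (s + a + c * t) % n       ≡⟨ pow-periodic period c s ⟩
    v ^ (s + a) % n               ∎
    where
    open ≡-Reasoning
    regroup : ∀ s a t c → s + a + (t + c * t) ≡ s + c * t + (a + t)
    regroup = solve-∀
    swap : ∀ s a u → s + u + a ≡ s + a + u
    swap = solve-∀

  private
    residue : Fin (suc n) → Fin n
    residue k = fromℕ< (m%n<n (v ^ suc (toℕ k)) n)

  -- By the pigeonhole principle two of v, v², …, v^(n+1) agree modulo n.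
  powers-repeat : ∃ λ a → ∃ λ t → 1 ≤ a × 1 ≤ t × v ^ (a + t) % n ≡ v ^ a % n
  powers-repeat with Finₚ.pigeonhole (n<1+n n) residue
  ... | i , j , i<j , same = suc (toℕ i) , toℕ j ∸ toℕ i , s≤s z≤n , m<n⇒0<n∸m i<j , repeat
    where
    open ≡-Reasoning
    repeat : v ^ (suc (toℕ i) + (toℕ j ∸ toℕ i)) % n ≡ v ^ suc (toℕ i) % n
    repeat = begin
      v ^ (suc (toℕ i) + (toℕ j ∸ toℕ i)) % n ≡⟨ cong (λ k → v ^ suc k % n) (m+[n∸m]≡n (<⇒≤ i<j)) ⟩
      v ^ suc (toℕ j) % n                     ≡⟨ sym (Finₚ.toℕ-fromℕ< (m%n<n (v ^ suc (toℕ j)) n)) ⟩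
      toℕ (fromℕ< (m%n<n (v ^ suc (toℕ j)) n)) ≡⟨ cong toℕ (sym same) ⟩
      toℕ (fromℕ< (m%n<n (v ^ suc (toℕ i)) n)) ≡⟨ Finₚ.toℕ-fromℕ< (m%n<n (v ^ suc (toℕ i)) n) ⟩
      v ^ suc (toℕ i) % n                     ∎

  -- Some positive power v^N is idempotent modulo n: if v^(a+t) ≡ v^a then
  -- N = a·t works, since N ≥ a and N + N is N plus a multiple of t.
  idempotent-power : ∃ λ N → 1 ≤ N × (v ^ N * v ^ N) % n ≡ v ^ N % n
  idempotent-power with powers-repeat
  ... | a , t , 1≤a , 1≤t , period = a * t , *-mono-≤ 1≤a 1≤t , idempotent
    where
    open ≡-Reasoning
    N : ℕ
    N = a * t
    a≤N : a ≤ N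
    a≤N = m≤m*n a t {{>-nonZero 1≤t}}
    N≡[N∸a]+a : N ∸ a + a ≡ N
    N≡[N∸a]+a = m∸n+n≡m a≤N
    idempotent : (v ^ N * v ^ N) % n ≡ v ^ N % n
    idempotent = begin
      (v ^ N * v ^ N) % n         ≡⟨ cong (_% n) (sym (^-distribˡ-+-* v N N)) ⟩
      v ^ (N + N) % n             ≡⟨ cong (λ k → v ^ (k + N) % n) (sym N≡[N∸a]+a) ⟩
      v ^ (N ∸ a + a + a * t) % n ≡⟨ pow-periodic period a (N ∸ a) ⟩
      v ^ (N ∸ a + a) % n         ≡⟨ cong (λ k → v ^ k % n) N≡[N∸a]+a ⟩
      v ^ N % n                   ∎

PairwiseCoprime : ∀ {r} → (Fin r → ℕ) → Set
PairwiseCoprime f = ∀ k l → k ≢ l → Coprime (f k) (f l)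

prodFin-cong : ∀ {r} (f g : Fin r → ℕ) → (∀ i → f i ≡ g i) → prodFin f ≡ prodFin g
prodFin-cong {zero}  f g f≗g = refl
prodFin-cong {suc r} f g f≗g =
  cong₂ _*_ (f≗g Fin.zero) (prodFin-cong (λ i → f (Fin.suc i)) (λ i → g (Fin.suc i)) (λ i → f≗g (Fin.suc i)))

prodFin-* : ∀ {r} (f g : Fin r → ℕ) → prodFin (λ i → f i * g i) ≡ prodFin f * prodFin g
prodFin-* {zero}  f g = refl
prodFin-* {suc r} f g =
  trans (cong (f Fin.zero * g Fin.zero *_) (prodFin-* (λ i → f (Fin.suc i)) (λ i → g (Fin.suc i))))
        ([m*n]*[o*p]≡[m*o]*[n*p] (f Fin.zero) (g Fin.zero) _ _)

prodFin-nonZero : ∀ {r} (f : Fin r → ℕ) → (∀ i → NonZero (f i)) → NonZero (prodFin f)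
prodFin-nonZero {zero}  f nz = _
prodFin-nonZero {suc r} f nz =
  m*n≢0 (f Fin.zero) _ {{nz Fin.zero}} {{prodFin-nonZero (λ i → f (Fin.suc i)) (λ i → nz (Fin.suc i))}}

factor∣prodFin : ∀ {r} (f : Fin r → ℕ) k → f k ∣ prodFin f
factor∣prodFin {suc r} f Fin.zero    = m∣m*n _
factor∣prodFin {suc r} f (Fin.suc k) = ∣n⇒∣m*n (f Fin.zero) (factor∣prodFin (λ i → f (Fin.suc i)) k)

prodFin-mono-∣ : ∀ {r} (f g : Fin r → ℕ) → (∀ i → f i ∣ g i) → prodFin f ∣ prodFin g
prodFin-mono-∣ {zero}  f g f∣g = ∣-refl
prodFin-mono-∣ {suc r} f g f∣g =
  *-pres-∣ (f∣g Fin.zero) (prodFin-mono-∣ (λ i → f (Fin.suc i)) (λ i → g (Fin.suc i)) (λ i → f∣g (Fin.suc i)))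

coprime-prodFin : ∀ {r x} (f : Fin r → ℕ) → (∀ k → Coprime x (f k)) → Coprime x (prodFin f)
coprime-prodFin {zero}  f c = coprime-1 _
coprime-prodFin {suc r} f c = coprime-*ʳ (c Fin.zero) (coprime-prodFin (λ i → f (Fin.suc i)) (λ k → c (Fin.suc k)))

prodFin∣ : ∀ {r x} (f : Fin r → ℕ) → PairwiseCoprime f → (∀ k → f k ∣ x) → prodFin f ∣ x
prodFin∣ {zero}  f cop f∣x = 1∣ _
prodFin∣ {suc r} f cop f∣x = coprime-∣-* head-coprime-tail (f∣x Fin.zero) (prodFin∣ tail tail-cop (λ k → f∣x (Fin.suc k)))
  where
  tail : Fin r → ℕ
  tail i = f (Fin.suc i)
  tail-cop : PairwiseCoprime tail
  tail-cop k l k≢l = cop (Fin.suc k) (Fin.suc l) (λ sk≡sl → k≢l (Finₚ.suc-injective sk≡sl))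
  head-coprime-tail : Coprime (f Fin.zero) (prodFin tail)
  head-coprime-tail = coprime-prodFin tail (λ k → cop Fin.zero (Fin.suc k) (λ ()))

_↾_ : ∀ {r} → (Fin r → ℕ) → (Fin r → Bool) → Fin r → ℕ
(f ↾ I) i = if I i then f i else 1

_↾ᶜ_ : ∀ {r} → (Fin r → ℕ) → (Fin r → Bool) → Fin r → ℕ
(f ↾ᶜ I) i = if I i then 1 else f i

module _ {r : ℕ} (f : Fin r → ℕ) (I : Fin r → Bool) where

  ↾-∣ : ∀ k → (f ↾ I) k ∣ f k
  ↾-∣ k with I k
  ... | true  = ∣-refl
  ... | false = 1∣ _

  ∈⇒∣prod↾ : ∀ {k} → I k ≡ true → f k ∣ prodFin (f ↾ I)
  ∈⇒∣prod↾ {k} Ik = subst (_∣ prodFin (f ↾ I)) (cong (λ b → if b then f k else 1) Ik) (factor∣prodFin (f ↾ I) k)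

  ∉⇒∣prod↾ᶜ : ∀ {k} → I k ≡ false → f k ∣ prodFin (f ↾ᶜ I)
  ∉⇒∣prod↾ᶜ {k} Ik = subst (_∣ prodFin (f ↾ᶜ I)) (cong (λ b → if b then 1 else f k) Ik) (factor∣prodFin (f ↾ᶜ I) k)

  prodFin-split : prodFin f ≡ prodFin (f ↾ I) * prodFin (f ↾ᶜ I)
  prodFin-split = trans (prodFin-cong f _ split) (prodFin-* (f ↾ I) (f ↾ᶜ I))
    where
    split : ∀ i → f i ≡ (f ↾ I) i * (f ↾ᶜ I) i
    split i with I i
    ... | true  = sym (*-identityʳ (f i))
    ... | false = sym (+-identityʳ (f i))

  module _ (cop : PairwiseCoprime f) where

    prod↾∣ : ∀ {x} → (∀ k → I k ≡ true → f k ∣ x) → prodFin (f ↾ I) ∣ x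
    prod↾∣ {x} f∣x = prodFin∣ (f ↾ I) ↾-cop factor∣x
      where
      ↾-cop : PairwiseCoprime (f ↾ I)
      ↾-cop k l k≢l = coprime-∣ʳ (↾-∣ l) (coprime-∣ˡ (↾-∣ k) (cop k l k≢l))
      factor∣x : ∀ k → (f ↾ I) k ∣ x
      factor∣x k with I k in Ik
      ... | true  = f∣x k Ik
      ... | false = 1∣ x

    prod↾-coprime-prod↾ᶜ : Coprime (prodFin (f ↾ I)) (prodFin (f ↾ᶜ I))
    prod↾-coprime-prod↾ᶜ =
      Coprimality.sym (coprime-prodFin (f ↾ I) λ k →
        Coprimality.sym (coprime-prodFin (f ↾ᶜ I) λ l → factors-coprime k l))
      where
      factors-coprime : ∀ k l → Coprime ((f ↾ I) k) ((f ↾ᶜ I) l)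
      factors-coprime k l with I k in Ik | I l in Il
      ... | false | _     = Coprimality.sym (coprime-1 _)
      ... | true  | true  = coprime-1 _
      ... | true  | false = cop k l (λ k≡l → contradiction (trans (sym Ik) (trans (cong I k≡l) Il)) λ ())

length-concat-map : ∀ {A B : Set} (f : A → List B) xs → length (concat (map f xs)) ≡ sum (map (λ x → length (f x)) xs)
length-concat-map f []       = refl
length-concat-map f (x ∷ xs) = trans (length-++ (f x)) (cong (length (f x) +_) (length-concat-map f xs))

unique-concat-map : ∀ {A B : Set} {P : A → Set} (f : A → List B) {xs} →
  (∀ {x} → P x → Unique (f x)) → (∀ {x y} → P x → P y → x ≢ y → Disjoint (f x) (f y)) →
  Unique xs → All P xs → Unique (concat (map f xs))
unique-concat-map f uniq disj []               []         = []
unique-concat-map f {x ∷ xs} uniq disj (x∉xs ∷ u) (px ∷ pxs) =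
  Unique.++⁺ (uniq px) (unique-concat-map f uniq disj u pxs) disjoint-from-rest
  where
  disjoint-from-rest : Disjoint (f x) (concat (map f xs))
  disjoint-from-rest (v∈fx , v∈rest) with ∈-concat⁻′ (map f xs) v∈rest
  ... | _ , v∈fy , fy∈ with ∈-map⁻ f fy∈
  ... | y , y∈xs , refl = disj px (All.lookup pxs y∈xs) (All.lookup x∉xs y∈xs) (v∈fx , v∈fy)

∈-1…n⁺ : ∀ {k n} → 1 ≤ k → k ≤ n → k ∈ map suc (upTo n)
∈-1…n⁺ {suc k} _ k<n = ∈-map⁺ suc (∈-upTo⁺ k<n)

∈-1…n⁻ : ∀ {k n} → k ∈ map suc (upTo n) → 1 ≤ k × k ≤ n
∈-1…n⁻ k∈ with ∈-map⁻ suc k∈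
... | _ , k-1∈ , refl = s≤s z≤n , ∈-upTo⁻ k-1∈

unique-1…n : ∀ n → Unique (map suc (upTo n))
unique-1…n n = Unique.map⁺ suc-injective (Unique.upTo⁺ n)

totatives : ℕ → List ℕ
totatives n = filter (λ k → gcd k n ≟ 1) (map suc (upTo n))

properDivisors : ℕ → List ℕ
properDivisors n = filter (λ y → ¬? (y ≟ n)) (filter (λ y → y ∣? n) (map suc (upTo n)))

∈-properDivisors⁺ : ∀ {y n} .{{_ : NonZero n}} → y ∣ n → y ≢ n → y ∈ properDivisors n
∈-properDivisors⁺ {y} {n} y∣n y≢n =
  ∈-filter⁺ (λ y → ¬? (y ≟ n)) (∈-filter⁺ (λ y → y ∣? n) (∈-1…n⁺ 1≤y (∣⇒≤ y∣n)) y∣n) y≢n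
  where
  1≤y : 1 ≤ y
  1≤y = >-nonZero⁻¹ y {{≢-nonZero (λ y≡0 → ≢-nonZero⁻¹ n (0∣⇒≡0 (subst (_∣ n) y≡0 y∣n)))}}

∈-properDivisors⁻ : ∀ {y n} → y ∈ properDivisors n → y ∣ n × y ≢ n
∈-properDivisors⁻ {y} {n} y∈ with ∈-filter⁻ (λ y → ¬? (y ≟ n)) {xs = filter (λ y → y ∣? n) (map suc (upTo n))} y∈
... | y∈divisors , y≢n = proj₂ (∈-filter⁻ (λ y → y ∣? n) {xs = map suc (upTo n)} y∈divisors) , y≢n

unique-properDivisors : ∀ n → Unique (properDivisors n)
unique-properDivisors n = Unique.filter⁺ (λ y → ¬? (y ≟ n)) (Unique.filter⁺ (λ y → y ∣? n) (unique-1…n n))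

gcd[0,n]≢1 : ∀ {n} → 2 ≤ n → gcd 0 n ≢ 1
gcd[0,n]≢1 {n} 2≤n gcd≡1 = <⇒≢ 2≤n (sym (trans (sym (gcd-identityˡ n)) gcd≡1))

gcd[n,n]≢1 : ∀ {n} → 2 ≤ n → gcd n n ≢ 1
gcd[n,n]≢1 {n} 2≤n gcd≡1 = <⇒≢ 2≤n (sym (∣1⇒≡1 (subst (n ∣_) gcd≡1 (gcd-greatest ∣-refl ∣-refl))))

multiples : ℕ → ℕ → List ℕ
multiples D n = map (D *_) (totatives n)

module Multiples (D n : ℕ) .{{_ : NonZero D}} (2≤n : 2 ≤ n) where

  gcd-scaled : ∀ k → gcd (D * k) (D * n) ≡ D * gcd k n
  gcd-scaled k = sym (c*gcd[m,n]≡gcd[cm,cn] D k n)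

  ∈-multiples⁻ : ∀ {v} → v ∈ multiples D n → v < D * n × gcd v (D * n) ≡ D
  ∈-multiples⁻ v∈ with ∈-map⁻ (D *_) v∈
  ... | k , k∈ , refl with ∈-filter⁻ (λ k → gcd k n ≟ 1) {xs = map suc (upTo n)} k∈
  ... | k∈1…n , gcd≡1 =
    *-monoʳ-< D (≤∧≢⇒< (proj₂ (∈-1…n⁻ k∈1…n)) (λ { refl → gcd[n,n]≢1 2≤n gcd≡1 })) ,
    trans (gcd-scaled k) (trans (cong (D *_) gcd≡1) (*-identityʳ D))

  ∈-multiples⁺ : ∀ {v} → v < D * n → gcd v (D * n) ≡ D → v ∈ multiples D n
  ∈-multiples⁺ {v} v<Dn gcd≡D = subst (_∈ multiples D n) (sym v≡D*k)
    (∈-map⁺ (D *_) (∈-filter⁺ (λ k → gcd k n ≟ 1) (∈-1…n⁺ 1≤k (<⇒≤ k<n)) gcd≡1))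
    where
    D∣v : D ∣ v
    D∣v = subst (_∣ v) gcd≡D (gcd[m,n]∣m v (D * n))
    k : ℕ
    k = quotient D∣v
    v≡D*k : v ≡ D * k
    v≡D*k = m∣n⇒n≡m*quotient D∣v
    gcd≡1 : gcd k n ≡ 1
    gcd≡1 = *-cancelˡ-≡ (gcd k n) 1 D (trans (sym (gcd-scaled k))
              (trans (cong (λ x → gcd x (D * n)) (sym v≡D*k)) (trans gcd≡D (sym (*-identityʳ D)))))
    1≤k : 1 ≤ k
    1≤k with k in k≡
    ... | zero  = contradiction (subst (λ x → gcd x n ≡ 1) k≡ gcd≡1) (gcd[0,n]≢1 2≤n)
    ... | suc _ = s≤s z≤n
    k<n : k < n
    k<n = *-cancelˡ-< D k n (subst (_< D * n) v≡D*k v<Dn)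

  unique-multiples : Unique (multiples D n)
  unique-multiples = Unique.map⁺ (λ {a} {b} → *-cancelˡ-≡ a b D)
    (Unique.filter⁺ (λ k → gcd k n ≟ 1) (unique-1…n n))

divN≡/ : ∀ a b .{{_ : NonZero b}} → a divN b ≡ a / b
divN≡/ a (suc b) = refl

power-edge : ∀ m .{{_ : NonZero m}} a n → 1 ≤ n → Edge m (a ^ n % m) (a ^ suc n % m)
power-edge m a n 1≤n = m%n<n _ m , m%n<n _ m , a , n , 1≤n , reduced (a ^ n) , reduced (a ^ suc n)
  where
  reduced : ∀ x → (x % m) ≡[mod m ] x
  reduced x = %≡⇒≡[mod] m (m%n%n≡m%n x m)

descend : ∀ m .{{_ : NonZero m}} {b} a j n → 1 ≤ n →
          Connected m b (a ^ (j + n) % m) → Connected m b (a ^ n % m)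
descend m a zero    n _   path = path
descend m {b} a (suc j) n 1≤n path =
  bwd (descend m a j (suc n) (s≤s z≤n) (subst (λ k → Connected m b (a ^ k % m)) (sym (+-suc j n)) path))
      (power-edge m a n 1≤n)

module Modulus {r : ℕ} (p e : Fin r → ℕ) (prime : ∀ i → Prime (p i))
               (p-inj : Injective _≡_ _≡_ p) (e≥1 : ∀ i → 1 ≤ e i) where

  q : Fin r → ℕ
  q i = p i ^ e i

  m : ℕ
  m = modulus p e

  instance
    p≢0 : ∀ {i} → NonZero (p i)
    p≢0 {i} = prime⇒nonZero (prime i)

    q≢0 : ∀ {i} → NonZero (q i)
    q≢0 {i} = m^n≢0 (p i) (e i)

    m≢0 : NonZero m
    m≢0 = prodFin-nonZero q (λ i → q≢0)

  p∣q : ∀ k → p k ∣ q k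
  p∣q k = subst (λ n → p k ∣ p k ^ n) (m+[n∸m]≡n (e≥1 k)) (∣⇒∣^suc (e k ∸ 1) ∣-refl)

  q∣m : ∀ k → q k ∣ m
  q∣m = factor∣prodFin q

  p∣m : ∀ k → p k ∣ m
  p∣m k = ∣-trans (p∣q k) (q∣m k)

  p-coprime : PairwiseCoprime p
  p-coprime k l k≢l = primes-coprime (prime k) (prime l) (k≢l ∘ p-inj)

  q-coprime : PairwiseCoprime q
  q-coprime k l k≢l = coprime-^ (e k) (e l) (p-coprime k l k≢l)

  %m⇒%q : ∀ k {a b} → a % m ≡ b % m → a % q k ≡ b % q k
  %m⇒%q k = %≡-∣ (q k) m (q∣m k)

  crt : ∀ {a b} → (∀ k → a % q k ≡ b % q k) → a % m ≡ b % m
  crt {a} {b} a≡b with ≤-total b a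
  ... | inj₁ b≤a = ∣∸⇒%≡ m b≤a (prodFin∣ q q-coprime (λ k → %≡⇒∣∸ (q k) b≤a (a≡b k)))
  ... | inj₂ a≤b = sym (∣∸⇒%≡ m a≤b (prodFin∣ q q-coprime (λ k → %≡⇒∣∸ (q k) a≤b (sym (a≡b k)))))

  SamePrimes : ℕ → ℕ → Set
  SamePrimes x y = ∀ k → (p k ∣ x → p k ∣ y) × (p k ∣ y → p k ∣ x)

  SamePrimes-sym : ∀ {x y} → SamePrimes x y → SamePrimes y x
  SamePrimes-sym same k = proj₂ (same k) , proj₁ (same k)

  SamePrimes-trans : ∀ {x y z} → SamePrimes x y → SamePrimes y z → SamePrimes x z
  SamePrimes-trans x~y y~z k = proj₁ (y~z k) ∘ proj₁ (x~y k) , proj₂ (x~y k) ∘ proj₂ (y~z k)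

  %m⇒SamePrimes : ∀ {x y} → x % m ≡ y % m → SamePrimes x y
  %m⇒SamePrimes x≡y k = ∣-resp-%≡ (p k) m (p∣m k) x≡y , ∣-resp-%≡ (p k) m (p∣m k) (sym x≡y)

  ^-SamePrimes : ∀ x {n} → 1 ≤ n → SamePrimes (x ^ n) x
  ^-SamePrimes x {suc n} _ k = prime∣^⇒∣ (suc n) (prime k) , ∣⇒∣^suc n

  edge-SamePrimes : ∀ {b c} → Edge m b c → SamePrimes b c
  edge-SamePrimes (_ , _ , a , i , 1≤i , b≡a^i , c≡a^i+1) =
    SamePrimes-trans (%m⇒SamePrimes (≡[mod]⇒%≡ m b≡a^i))
      (SamePrimes-trans (^-SamePrimes a 1≤i)
        (SamePrimes-sym (SamePrimes-trans (%m⇒SamePrimes (≡[mod]⇒%≡ m c≡a^i+1)) (^-SamePrimes a {suc i} (s≤s z≤n)))))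

  module Support (I : Fin r → Bool) where

    HasSupport : ℕ → Set
    HasSupport v = ∀ k → (I k ≡ true → p k ∣ v) × (I k ≡ false → ¬ p k ∣ v)

    SamePrimes⇒HasSupport : ∀ {x y} → SamePrimes x y → HasSupport x → HasSupport y
    SamePrimes⇒HasSupport same sx k = proj₁ (same k) ∘ proj₁ (sx k) , λ Ik → proj₂ (sx k) Ik ∘ proj₂ (same k)

    IdempotentPattern : ℕ → Set
    IdempotentPattern w = ∀ k → (I k ≡ true → q k ∣ w) × (I k ≡ false → w % q k ≡ 1 % q k)

    idempotent-pattern : ∀ {w} → HasSupport w → (w * w) % m ≡ w % m → IdempotentPattern w
    idempotent-pattern {w} sw idem k =
      (λ Ik → fixed-by-multiple-of-p (prime k) (e k) w w (proj₁ (sw k) Ik) (%m⇒%q k idem)) ,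
      (λ Ik → idempotent-unit≡1 (prime k) (e k) w (proj₂ (sw k) Ik) (%m⇒%q k idem))

    pattern⇒HasSupport : ∀ {w} → IdempotentPattern w → HasSupport w
    pattern⇒HasSupport pw k =
      (λ Ik → ∣-trans (p∣q k) (proj₁ (pw k) Ik)) ,
      (λ Ik p∣w → prime∤1 (prime k) (∣-resp-%≡ (p k) (q k) (p∣q k) (proj₂ (pw k) Ik) p∣w))

    -- By the Chinese remainder theorem the pattern determines w modulo m.
    pattern-unique : ∀ {w w′} → IdempotentPattern w → IdempotentPattern w′ → w % m ≡ w′ % m
    pattern-unique {w} {w′} pw pw′ = crt same-residue
      where
      same-residue : ∀ k → w % q k ≡ w′ % q k
      same-residue k with I k in Ik
      ... | true  = ∣∧∣⇒%≡ (q k) (proj₁ (pw k) Ik) (proj₁ (pw′ k) Ik)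
      ... | false = trans (proj₂ (pw k) Ik) (sym (proj₂ (pw′ k) Ik))

    g : ℕ
    g = prodFin (q ↾ I)

    π : ℕ
    π = prodFin (p ↾ I)

    m′ : ℕ
    m′ = prodFin (q ↾ᶜ I)

    m≡g*m′ : m ≡ g * m′
    m≡g*m′ = prodFin-split q I

    g-coprime-m′ : Coprime g m′
    g-coprime-m′ = prod↾-coprime-prod↾ᶜ q I q-coprime

    π∣g : π ∣ g
    π∣g = prodFin-mono-∣ (p ↾ I) (q ↾ I) p↾∣q↾
      where
      p↾∣q↾ : ∀ k → (p ↾ I) k ∣ (q ↾ I) k
      p↾∣q↾ k with I k
      ... | true  = p∣q k
      ... | false = ∣-refl

    instance
      g≢0 : NonZero g
      g≢0 = m*n≢0⇒m≢0 g {{subst NonZero m≡g*m′ m≢0}}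

      m′≢0 : NonZero m′
      m′≢0 = m*n≢0⇒n≢0 g {{subst NonZero m≡g*m′ m≢0}}

    m′≥2 : (∃ λ j → I j ≡ false) → 2 ≤ m′
    m′≥2 (j , Ij) = ≤-trans (nonTrivial⇒n>1 (p j) {{prime⇒nonTrivial (prime j)}})
      (∣⇒≤ (∣-trans (p∣q j) (∉⇒∣prod↾ᶜ q I Ij)))

    support⇒π∣ : ∀ {v} → HasSupport v → π ∣ v
    support⇒π∣ sv = prod↾∣ p I p-coprime (λ k → proj₁ (sv k))

    support⇒coprime : ∀ {v} → HasSupport v → Coprime v m′
    support⇒coprime {v} sv = coprime-prodFin (q ↾ᶜ I) coprime-factor
      where
      coprime-factor : ∀ k → Coprime v ((q ↾ᶜ I) k)
      coprime-factor k with I k in Ik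
      ... | true  = coprime-1 v
      ... | false = coprime-^ʳ (e k) (Coprimality.sym (prime∤⇒coprime (prime k) (proj₂ (sv k) Ik)))

    π∣∧coprime⇒support : ∀ {v} → π ∣ v → Coprime v m′ → HasSupport v
    π∣∧coprime⇒support π∣v v⊥m′ k =
      (λ Ik → ∣-trans (∈⇒∣prod↾ p I Ik) π∣v) ,
      (λ Ik p∣v → prime≢1 (prime k) (v⊥m′ (p∣v , ∣-trans (p∣q k) (∉⇒∣prod↾ᶜ q I Ik))))

    returning⇒g∣ : ∀ {v} → HasSupport v → ∀ k → v ^ suc (suc k) % m ≡ v % m → g ∣ v
    returning⇒g∣ {v} sv k v^k+2≡v = prod↾∣ q I q-coprime q∣v
      where
      q∣v : ∀ l → I l ≡ true → q l ∣ v
      q∣v l Il = fixed-by-multiple-of-p (prime l) (e l) v (v ^ suc k)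
        (∣⇒∣^suc k (proj₁ (sv l) Il)) (%m⇒%q l v^k+2≡v)

    support∧¬g∣⇒tail : ∀ {v} → HasSupport v → ¬ g ∣ v → IsTail m v
    support∧¬g∣⇒tail sv g∤v zero    ()
    support∧¬g∣⇒tail sv g∤v (suc k) _ v^k+2≡v = g∤v (returning⇒g∣ sv k (≡[mod]⇒%≡ m v^k+2≡v))

    module Idempotent (d : ℕ) (isDI : IsDI p e I d) where

      d<m : d < m
      d<m = proj₁ isDI

      dI-pattern : IdempotentPattern d
      dI-pattern k =
        (λ Ik → m%n≡0⇒n∣m d (q k) (trans (≡[mod]⇒%≡ (q k) (proj₁ (proj₂ isDI) k Ik)) (n∣m⇒m%n≡0 0 (q k) (q k ∣0)))) ,
        (λ Ik → ≡[mod]⇒%≡ (q k) (proj₂ (proj₂ isDI) k Ik))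

      idempotent≡dI : ∀ {w} → HasSupport w → (w * w) % m ≡ w % m → w % m ≡ d
      idempotent≡dI sw idem = trans (pattern-unique (idempotent-pattern sw idem) dI-pattern) (m<n⇒m%n≡m d<m)

      power≡dI : ∀ {v} → HasSupport v → ∃ λ N → 1 ≤ N × v ^ N % m ≡ d
      power≡dI {v} sv =
        let N , 1≤N , idem = idempotent-power m v
        in N , 1≤N , idempotent≡dI (SamePrimes⇒HasSupport (SamePrimes-sym (^-SamePrimes v 1≤N)) sv) idem

      dI-support : HasSupport d
      dI-support = pattern⇒HasSupport dI-pattern

      connected⇒support : ∀ {v} → Connected m d v → v < m × HasSupport v
      connected⇒support (here _)        = d<m , dI-support
      connected⇒support (fwd path edge) =
        proj₁ (proj₂ edge) , SamePrimes⇒HasSupport (edge-SamePrimes edge) (proj₂ (connected⇒support path))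
      connected⇒support (bwd path edge) =
        proj₁ edge , SamePrimes⇒HasSupport (SamePrimes-sym (edge-SamePrimes edge)) (proj₂ (connected⇒support path))

      -- Conversely a residue v of support I is joined to d_I ≡ v^N through v, v², …, v^N.
      support⇒connected : ∀ {v} → v < m → HasSupport v → Connected m d v
      support⇒connected {v} v<m sv = subst (Connected m d) v^1≡v (descend m v (N ∸ 1) 1 (s≤s z≤n) from-d)
        where
        N : ℕ
        N = proj₁ (power≡dI sv)
        1≤N : 1 ≤ N
        1≤N = proj₁ (proj₂ (power≡dI sv))
        v^N≡d : v ^ N % m ≡ d
        v^N≡d = proj₂ (proj₂ (power≡dI sv))
        PowerConnected : ℕ → Set
        PowerConnected k = Connected m d (v ^ k % m)
        from-d : PowerConnected (N ∸ 1 + 1)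
        from-d = subst PowerConnected (sym (m∸n+n≡m 1≤N)) (subst (Connected m d) (sym v^N≡d) (here d<m))
        v^1≡v : v ^ 1 % m ≡ v
        v^1≡v = trans (cong (_% m) (*-identityʳ v)) (m<n⇒m%n≡m v<m)

      g∣⇒*dI≡ : ∀ {v} → g ∣ v → (v * d) % m ≡ v % m
      g∣⇒*dI≡ {v} g∣v = crt same-residue
        where
        same-residue : ∀ k → (v * d) % q k ≡ v % q k
        same-residue k with I k in Ik
        ... | true  = ∣∧∣⇒%≡ (q k) (∣m⇒∣m*n d q∣v) q∣v
          where
          q∣v : q k ∣ v
          q∣v = ∣-trans (∈⇒∣prod↾ q I Ik) g∣v
        ... | false = trans (%-cong-*ˡ (q k) v (proj₂ (dI-pattern k) Ik)) (cong (_% q k) (*-identityʳ v))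

      -- So a multiple of g_I with support I is no tail: v^(N+1) ≡ v·d_I ≡ v.
      tail⇒¬g∣ : ∀ {v} → HasSupport v → IsTail m v → ¬ g ∣ v
      tail⇒¬g∣ {v} sv tail g∣v =
        let N , 1≤N , v^N≡d = power≡dI sv
        in tail N 1≤N (%≡⇒≡[mod] m (begin
          v ^ suc N % m ≡⟨ %-cong-*ˡ m v (trans v^N≡d (sym (m<n⇒m%n≡m d<m))) ⟩
          (v * d) % m   ≡⟨ g∣⇒*dI≡ g∣v ⟩
          v % m         ∎))
        where open ≡-Reasoning

module Counting (m g m′ π : ℕ) (m≡g*m′ : m ≡ g * m′) {{g≢0 : NonZero g}} (π∣g : π ∣ g)
                (g⊥m′ : Coprime g m′) (m′≥2 : 2 ≤ m′) where

  h : ℕ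
  h = g divN π

  instance
    π≢0 : NonZero π
    π≢0 = ≢-nonZero (λ π≡0 → ≢-nonZero⁻¹ g (0∣⇒≡0 (subst (_∣ g) π≡0 π∣g)))

  g≡h*π : g ≡ h * π
  g≡h*π = sym (trans (cong (_* π) (divN≡/ g π)) (m/n*n≡m π∣g))

  instance
    h≢0 : NonZero h
    h≢0 = m*n≢0⇒m≢0 h {{subst NonZero g≡h*π g≢0}}

  g∣m : g ∣ m
  g∣m = divides m′ (trans m≡g*m′ (*-comm g m′))

  -- gcd(v, m) is a multiple of π dividing g, hence y·π with y ∣ h; y = h would give g ∣ v.
  class⇒gcd : ∀ {v} → π ∣ v → Coprime v m′ → ¬ g ∣ v → ∃ λ y → y ∈ properDivisors h × gcd v m ≡ y * π
  class⇒gcd {v} π∣v v⊥m′ g∤v = y , ∈-properDivisors⁺ y∣h y≢h , gcd≡y*π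
    where
    gcd∣g : gcd v m ∣ g
    gcd∣g = coprime-divisor (coprime-∣ˡ (gcd[m,n]∣m v m) v⊥m′)
              (subst (gcd v m ∣_) (trans m≡g*m′ (*-comm g m′)) (gcd[m,n]∣n v m))
    π∣gcd : π ∣ gcd v m
    π∣gcd = gcd-greatest π∣v (∣-trans π∣g g∣m)
    y : ℕ
    y = quotient π∣gcd
    gcd≡y*π : gcd v m ≡ y * π
    gcd≡y*π = _∣_.equality π∣gcd
    y∣h : y ∣ h
    y∣h = *-cancelʳ-∣ π (subst₂ _∣_ gcd≡y*π g≡h*π gcd∣g)
    y≢h : y ≢ h
    y≢h y≡h = g∤v (subst (_∣ v) (trans gcd≡y*π (trans (cong (_* π) y≡h) (sym g≡h*π))) (gcd[m,n]∣m v m))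

  gcd⇒class : ∀ {v y} → y ∣ h → y ≢ h → gcd v m ≡ y * π → π ∣ v × Coprime v m′ × ¬ g ∣ v
  gcd⇒class {v} {y} y∣h y≢h gcd≡y*π = π∣v , v⊥m′ , g∤v
    where
    gcd∣g : gcd v m ∣ g
    gcd∣g = subst₂ _∣_ (sym gcd≡y*π) (sym g≡h*π) (*-monoˡ-∣ π y∣h)
    π∣v : π ∣ v
    π∣v = ∣-trans (divides y gcd≡y*π) (gcd[m,n]∣m v m)
    v⊥m′ : Coprime v m′
    v⊥m′ (c∣v , c∣m′) = g⊥m′ (∣-trans (gcd-greatest c∣v (∣-trans c∣m′ (divides g m≡g*m′))) gcd∣g , c∣m′)
    g∤v : ¬ g ∣ v
    g∤v g∣v = y≢h (*-cancelʳ-≡ y h π (trans (sym gcd≡y*π)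
                (trans (∣-antisym gcd∣g (gcd-greatest g∣v g∣m)) g≡h*π)))

  block : ℕ → List ℕ
  block y = multiples (y * π) (m divN (y * π))

  module Block {y : ℕ} (y∣h : y ∣ h) where

    D : ℕ
    D = y * π

    instance
      D≢0 : NonZero D
      D≢0 = m*n≢0 y π {{≢-nonZero (λ y≡0 → ≢-nonZero⁻¹ h (0∣⇒≡0 (subst (_∣ h) y≡0 y∣h)))}}

    D∣g : D ∣ g
    D∣g = subst (D ∣_) (sym g≡h*π) (*-monoˡ-∣ π y∣h)

    m≡D*n : m ≡ D * (m divN D)
    m≡D*n = sym (trans (cong (D *_) (divN≡/ m D)) (m*[n/m]≡n (∣-trans D∣g g∣m)))

    -- m / D = (g / D)·m′ ≥ m′ ≥ 2.
    2≤n : 2 ≤ m divN D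
    2≤n = ≤-trans m′≥2 (*-cancelˡ-≤ D (begin
      D * m′          ≤⟨ *-monoˡ-≤ m′ (∣⇒≤ D∣g) ⟩
      g * m′          ≡⟨ sym m≡g*m′ ⟩
      m               ≡⟨ m≡D*n ⟩
      D * (m divN D)  ∎))
      where open ≤-Reasoning

    open Multiples D (m divN D) 2≤n

    ∈-block⁻ : ∀ {v} → v ∈ block y → v < m × gcd v m ≡ D
    ∈-block⁻ {v} v∈ with ∈-multiples⁻ v∈
    ... | v<Dn , gcd≡D = subst (v <_) (sym m≡D*n) v<Dn , subst (λ x → gcd v x ≡ D) (sym m≡D*n) gcd≡D

    ∈-block⁺ : ∀ {v} → v < m → gcd v m ≡ D → v ∈ block y
    ∈-block⁺ {v} v<m gcd≡D = ∈-multiples⁺ (subst (v <_) m≡D*n v<m) (subst (λ x → gcd v x ≡ D) m≡D*n gcd≡D)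

    unique-block : Unique (block y)
    unique-block = unique-multiples

  classList : List ℕ
  classList = concat (map block (properDivisors h))

  ∈-classList⁻ : ∀ {v} → v ∈ classList → v < m × π ∣ v × Coprime v m′ × ¬ g ∣ v
  ∈-classList⁻ v∈ with ∈-concat⁻′ (map block (properDivisors h)) v∈
  ... | _ , v∈block , block∈ with ∈-map⁻ block block∈
  ... | y , y∈ , refl with ∈-properDivisors⁻ y∈
  ... | y∣h , y≢h with Block.∈-block⁻ y∣h v∈block
  ... | v<m , gcd≡D = v<m , gcd⇒class y∣h y≢h gcd≡D

  ∈-classList⁺ : ∀ {v} → v < m → π ∣ v → Coprime v m′ → ¬ g ∣ v → v ∈ classList
  ∈-classList⁺ v<m π∣v v⊥m′ g∤v with class⇒gcd π∣v v⊥m′ g∤v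
  ... | y , y∈ , gcd≡y*π =
    ∈-concat⁺′ (Block.∈-block⁺ (proj₁ (∈-properDivisors⁻ y∈)) v<m gcd≡y*π) (∈-map⁺ block y∈)

  -- Blocks have no repetitions and are disjoint, as gcd(v, m) determines y.
  unique-classList : Unique classList
  unique-classList = unique-concat-map block
    (λ y∣h → Block.unique-block y∣h)
    (λ {x} {y} x∣h y∣h x≢y (v∈x , v∈y) → x≢y (*-cancelʳ-≡ x y π
       (trans (sym (proj₂ (Block.∈-block⁻ x∣h v∈x))) (proj₂ (Block.∈-block⁻ y∣h v∈y)))))
    (unique-properDivisors h)
    (All.tabulate (λ y∈ → proj₁ (∈-properDivisors⁻ y∈)))

  length-classList : length classList ≡ sumProperDivisors h (λ y → φ (m divN (y * π)))
  length-classList = trans (length-concat-map block (properDivisors h))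
    (cong sum (map-cong (λ y → length-map _ (totatives (m divN (y * π)))) (properDivisors h)))

mainTheorem13 : (r : ℕ) (p e : Fin r → ℕ)
    → (∀ i → Prime (p i)) → Injective _≡_ _≡_ p → (∀ i → 1 ≤ e i)
    → (I : Fin r → Bool) → (∃ λ i → I i ≡ true) → (∃ λ j → I j ≡ false)
    → (d : ℕ) → IsDI p e I d
    → ∃ λ (L : List ℕ) → Unique L
        × (∀ v → (v ∈ L) ⇔ (Connected (modulus p e) d v × IsTail (modulus p e) v))
        × length L ≡ sumProperDivisors (gI p e I divN πI p I)
            (λ y → φ (modulus p e divN (y * πI p I)))
-- The tails of C_I are the v < m of support I with g_I ∤ v (parts 1 and 2), which
-- classList enumerates (part 3).
mainTheorem13 r p e prime p-inj e≥1 I _ some-j∉I d isDI =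
  classList , unique-classList , (λ v → mk⇔ ∈⇒tail tail⇒∈) , length-classList
  where
  open Modulus p e prime p-inj e≥1
  open Support I
  open Idempotent d isDI
  open Counting m g m′ π m≡g*m′ π∣g g-coprime-m′ (m′≥2 some-j∉I)

  ∈⇒tail : ∀ {v} → v ∈ classList → Connected m d v × IsTail m v
  ∈⇒tail {v} v∈ with ∈-classList⁻ v∈
  ... | v<m , π∣v , v⊥m′ , g∤v = support⇒connected v<m sv , support∧¬g∣⇒tail sv g∤v
    where
    sv : HasSupport v
    sv = π∣∧coprime⇒support π∣v v⊥m′

  tail⇒∈ : ∀ {v} → Connected m d v × IsTail m v → v ∈ classList
  tail⇒∈ (path , tail) with connected⇒support path
  ... | v<m , sv = ∈-classList⁺ v<m (support⇒π∣ sv) (support⇒coprime sv) (tail⇒¬g∣ sv tail)
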